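{- Let $\mathcal{Q}$ be a seminormal quasi-crystal. In the hypoplactic monoid $\mathrm{hypo}(\mathcal{Q})$, the idempotent elements commute (with each other).
   Context: Root system data: $V$ a finite-dimensional real inner product space, $\alpha^\vee=\frac{2}{\langle\alpha,\alpha\rangle}\alpha$; a root system $\Phi$ with fixed simple roots $(\alpha_i)_{i\in I}$ and weight lattice $\Lambda$ (a $\mathbb{Z}$-submodule of $V$ spanning $V$, containing $\Phi$, with $\langle\lambda,\alpha^\vee\rangle\in\mathbb{Z}$ for $\alpha\in\Phi$). A quasi-crystal of type $\Phi$ is a set $Q$ with maps $\mathrm{wt}:Q\to\Lambda$, $\ddot{e}_i,\ddot{f}_i:Q\to Q\sqcup\{\bot\}$ ($\bot$ = undefined), $\ddot{\varepsilon}_i,\ddot{\varphi}_i:Q\to\mathbb{Z}\cup\{\pm\infty\}$ ($i\in I$) such that: $\ddot{\varphi}_i(x)=\ddot{\varepsilon}_i(x)+\langle\mathrm{wt}(x),\alpha_i^\vee\rangle$ (with $m+(\pm\infty)=\pm\infty$); if $\ddot{e}_i(x)\in Q$ then $\mathrm{wt}(\ddot{e}_i(x))=\mathrm{wt}(x)+\alpha_i$, $\ddot{\varepsilon}_i(\ddot{e}_i(x))=\ddot{\varepsilon}_i(x)-1$, $\ddot{\varphi}_i(\ddot{e}_i(x))=\ddot{\varphi}_i(x)+1$; if $\ddot{f}_i(x)\in Q$ then $\mathrm{wt}(\ddot{f}_i(x))=\mathrm{wt}(x)-\alpha_i$, $\ddot{\varepsilon}_i(\ddot{f}_i(x))=\ddot{\varepsilon}_i(x)+1$,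 $\ddot{\varphi}_i(\ddot{f}_i(x))=\ddot{\varphi}_i(x)-1$; $\ddot{e}_i(x)=y\iff x=\ddot{f}_i(y)$; $\ddot{\varepsilon}_i(x)=\pm\infty$ implies $\ddot{e}_i(x)=\ddot{f}_i(x)=\bot$. Seminormal: whenever $\ddot{\varepsilon}_i(x)\ne+\infty$, $\ddot{\varepsilon}_i(x)=\max\{k\ge0:\ddot{e}_i^k(x)\in Q\}$ and $\ddot{\varphi}_i(x)=\max\{k\ge0:\ddot{f}_i^k(x)\in Q\}$. A quasi-crystal isomorphism between quasi-crystals with underlying sets $X,Y$ is a bijection $\psi:X\to Y$ preserving $\mathrm{wt},\ddot{\varepsilon}_i,\ddot{\varphi}_i$ such that $\ddot{e}_i(\psi(x))$ is defined iff $\ddot{e}_i(x)$ is, and then $\psi(\ddot{e}_i(x))=\ddot{e}_i(\psi(x))$; likewise for $\ddot{f}_i$. The free quasi-crystal monoid $\mathcal{Q}^{*}$: words over $Q$ with: for the empty word, $\mathrm{wt}=0$, $\ddot{\varepsilon}_i=\ddot{\varphi}_i=0$, $\ddot{e}_i,\ddot{f}_i$ undefined; for $w=x_1\cdots x_m$ ($m\ge1$), $\mathrm{wt}(w)=\sum_k\mathrm{wt}(x_k)$, and with $p=\max\{k:\ddot{\varepsilon}_i(x_k)>0\}$, $q=\min\{l:\ddot{\varphi}_i(x_l)>0\}$: if some $\ddot{\varepsilon}_i(x_k)=+\infty$, or $p,q$ exist with $p>q$, then $\ddot{\varepsilon}_i(w)=\ddot{\varphi}_i(w)=+\infty$ and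 $\ddot{e}_i,\ddot{f}_i$ undefined on $w$; otherwise $\ddot{\varepsilon}_i(w)=\sum_k\ddot{\varepsilon}_i(x_k)$, $\ddot{\varphi}_i(w)=\sum_k\ddot{\varphi}_i(x_k)$, $\ddot{e}_i(w)$ is defined iff $p$ exists and is then $w$ with $x_p$ replaced by $\ddot{e}_i(x_p)$, and $\ddot{f}_i(w)$ is defined iff $q$ exists and is then $w$ with $x_q$ replaced by $\ddot{f}_i(x_q)$. The connected component $Q^*(w)$ is the set of words obtained from $w$ by finitely many (defined) applications of operators $\ddot{e}_i,\ddot{f}_i$, with restricted structure. Hypoplactic congruence: $u\ddot{\sim}v$ iff there is a quasi-crystal isomorphism $Q^*(u)\to Q^*(v)$ sending $u$ to $v$; it is a congruence on the free monoid $Q^*$, and the hypoplactic monoid is $\mathrm{hypo}(\mathcal{Q})=Q^*/\ddot{\sim}$. -}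

module Defs where

open import Level using (0ℓ)
open import Data.Nat as ℕ using (ℕ; zero; suc)
open import Data.Integer as ℤ using (ℤ; +_)
open import Data.Bool using (Bool; true; false; if_then_else_; _∨_; _∧_)
open import Data.Maybe using (Maybe; just; nothing; is-just)
import Data.Maybe as Maybe
open import Data.List using (List; []; _∷_)
open import Data.Product using (Σ; ∃; _×_; _,_; proj₁; proj₂)
open import Relation.Binary.PropositionalEquality using (_≡_; _≢_)
open import Relation.Nullary using (¬_)
open import Relation.Nullary.Decidable using (⌊_⌋)
open import Algebra.Structures using (IsAbelianGroup)
open import Function.Bundles using (_⇔_)

-- Root datum: the part of (V, Φ, (α_i)_{i∈I}, Λ) used by quasi-crystals.
-- Λ is an abelian group (ℤ-module), α i ∈ Λ the simple roots, and
-- ⟨ λ , i ⟩ stands for ⟨λ, α_i^∨⟩ ∈ ℤ, additive in λ.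

record RootDatum : Set₁ where
  field
    I       : Set
    Λ       : Set
    _+ᴧ_    : Λ → Λ → Λ
    0ᴧ      : Λ
    -ᴧ_     : Λ → Λ
    isAbelianGroup : IsAbelianGroup _≡_ _+ᴧ_ 0ᴧ -ᴧ_
    α       : I → Λ
    ⟨_,_⟩   : Λ → I → ℤ
    ⟨⟩-+    : ∀ l m i → ⟨ l +ᴧ m , i ⟩ ≡ ⟨ l , i ⟩ ℤ.+ ⟨ m , i ⟩
    ⟨α,α∨⟩  : ∀ i → ⟨ α i , i ⟩ ≡ + 2

data ℤ∞ : Set where
  fin : ℤ → ℤ∞
  +∞  : ℤ∞
  -∞  : ℤ∞

-- m + (±∞) = ±∞ ; the case -∞ + +∞ never arises in the paper's uses.
infixl 6 _⊕_
_⊕_ : ℤ∞ → ℤ∞ → ℤ∞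
fin a ⊕ fin b = fin (a ℤ.+ b)
fin _ ⊕ y     = y
+∞    ⊕ _     = +∞
-∞    ⊕ +∞    = +∞
-∞    ⊕ _     = -∞

pos : ℤ∞ → Bool
pos (fin z) = ⌊ + 0 ℤ.<? z ⌋
pos +∞      = true
pos -∞      = false

isPlusInf : ℤ∞ → Bool
isPlusInf +∞ = true
isPlusInf _  = false

iter : {A : Set} → (A → Maybe A) → ℕ → A → Maybe A
iter g zero    x = just x
iter g (suc k) x = Maybe._>>=_ (iter g k x) g

Defined : {A : Set} → Maybe A → Set
Defined m = is-just m ≡ true

record QuasiCrystal (R : RootDatum) : Set₁ where
  open RootDatum R
  field
    Q  : Set
    wt : Q → Λ
    e f : I → Q → Maybe Q
    ε φ : I → Q → ℤ∞
    φ≡ε+wt : ∀ i x → φ i x ≡ ε i x ⊕ fin ⟨ wt x , i ⟩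
    e-wt : ∀ i x y → e i x ≡ just y → wt y ≡ wt x +ᴧ α i
    e-ε  : ∀ i x y → e i x ≡ just y → ε i y ≡ ε i x ⊕ fin (ℤ.- + 1)
    e-φ  : ∀ i x y → e i x ≡ just y → φ i y ≡ φ i x ⊕ fin (+ 1)
    f-wt : ∀ i x y → f i x ≡ just y → wt y ≡ wt x +ᴧ (-ᴧ α i)
    f-ε  : ∀ i x y → f i x ≡ just y → ε i y ≡ ε i x ⊕ fin (+ 1)
    f-φ  : ∀ i x y → f i x ≡ just y → φ i y ≡ φ i x ⊕ fin (ℤ.- + 1)
    e⇔f  : ∀ i x y → (e i x ≡ just y) ⇔ (f i y ≡ just x)
    +∞-undef : ∀ i x → ε i x ≡ +∞ → e i x ≡ nothing × f i x ≡ nothing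
    -∞-undef : ∀ i x → ε i x ≡ -∞ → e i x ≡ nothing × f i x ≡ nothing

IsMaxIter : {A : Set} → (A → Maybe A) → A → ℤ∞ → Set
IsMaxIter g x v =
  Σ ℕ λ k → (v ≡ fin (+ k)) × Defined (iter g k x) × ¬ Defined (iter g (suc k) x)

Seminormal : {R : RootDatum} → QuasiCrystal R → Set
Seminormal {R} 𝒬 = ∀ i x → ε i x ≢ +∞ → IsMaxIter (e i) x (ε i x) × IsMaxIter (f i) x (φ i x)
  where open QuasiCrystal 𝒬

findFirst : {A : Set} → (A → Bool) → List A → Maybe ℕ
findFirst p []       = nothing
findFirst p (x ∷ xs) = if p x then just 0 else Maybe.map suc (findFirst p xs)

findLast : {A : Set} → (A → Bool) → List A → Maybe ℕ
findLast p []       = nothing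
findLast p (x ∷ xs) with findLast p xs
... | just k  = just (suc k)
... | nothing = if p x then just 0 else nothing

anyB : {A : Set} → (A → Bool) → List A → Bool
anyB p []       = false
anyB p (x ∷ xs) = p x ∨ anyB p xs

updateAt : {A : Set} → ℕ → (A → Maybe A) → List A → Maybe (List A)
updateAt n       g []       = nothing
updateAt zero    g (x ∷ xs) = Maybe.map (_∷ xs) (g x)
updateAt (suc n) g (x ∷ xs) = Maybe.map (x ∷_) (updateAt n g xs)

module FreeQC {R : RootDatum} (𝒬 : QuasiCrystal R) where
  open RootDatum R
  open QuasiCrystal 𝒬

  Word : Set
  Word = List Q

  wtW : Word → Λ
  wtW []       = 0ᴧ
  wtW (x ∷ xs) = wt x +ᴧ wtW xs

  pIdx qIdx : I → Word → Maybe ℕ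
  pIdx i w = findLast  (λ x → pos (ε i x)) w
  qIdx i w = findFirst (λ x → pos (φ i x)) w

  pGtq : Maybe ℕ → Maybe ℕ → Bool
  pGtq (just p) (just q) = ⌊ q ℕ.<? p ⌋
  pGtq _        _        = false

  blocked : I → Word → Bool
  blocked i w = anyB (λ x → isPlusInf (ε i x)) w ∨ pGtq (pIdx i w) (qIdx i w)

  sumε sumφ : I → Word → ℤ∞
  sumε i []       = fin (+ 0)
  sumε i (x ∷ xs) = ε i x ⊕ sumε i xs
  sumφ i []       = fin (+ 0)
  sumφ i (x ∷ xs) = φ i x ⊕ sumφ i xs

  εW φW : I → Word → ℤ∞
  εW i w = if blocked i w then +∞ else sumε i w
  φW i w = if blocked i w then +∞ else sumφ i w

  eW fW : I → Word → Maybe Word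
  eW i w with blocked i w | pIdx i w
  ... | true  | _      = nothing
  ... | false | nothing = nothing
  ... | false | just p  = updateAt p (e i) w
  fW i w with blocked i w | qIdx i w
  ... | true  | _      = nothing
  ... | false | nothing = nothing
  ... | false | just q  = updateAt q (f i) w

  data Reach (u : Word) : Word → Set where
    here  : Reach u u
    stepE : ∀ {v w} i → Reach u v → eW i v ≡ just w → Reach u w
    stepF : ∀ {v w} i → Reach u v → fW i v ≡ just w → Reach u w

  -- quasi-crystal isomorphism Q*(u) → Q*(v) sending u to v,
  -- given by a map ψ on words restricted to the component Q*(u)
  record ComponentIso (u v : Word) : Set where
    field
      ψ    : Word → Word
      ψ⁻¹  : Word → Word
      ψ-u  : ψ u ≡ v
      ψ-in : ∀ {x} → Reach u x → Reach v (ψ x)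
      ψ⁻¹-in : ∀ {y} → Reach v y → Reach u (ψ⁻¹ y)
      left  : ∀ {x} → Reach u x → ψ⁻¹ (ψ x) ≡ x
      right : ∀ {y} → Reach v y → ψ (ψ⁻¹ y) ≡ y
      pres-wt : ∀ {x} → Reach u x → wtW (ψ x) ≡ wtW x
      pres-ε  : ∀ {x} → Reach u x → ∀ i → εW i (ψ x) ≡ εW i x
      pres-φ  : ∀ {x} → Reach u x → ∀ i → φW i (ψ x) ≡ φW i x
      pres-e  : ∀ {x} → Reach u x → ∀ i → eW i (ψ x) ≡ Maybe.map ψ (eW i x)
      pres-f  : ∀ {x} → Reach u x → ∀ i → fW i (ψ x) ≡ Maybe.map ψ (fW i x)

  -- hypoplactic congruence
  _∼_ : Word → Word → Set
  u ∼ v = ComponentIso u v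

-- Fix a colour i. If u ++ u ∼ u, the isomorphism preserves ε̈_i at the base
-- point, so ε̈_i(u ++ u) = ε̈_i(u). Either u is i-blocked (ε̈_i u = +∞), or,
-- by seminormality, all ε̈_i and φ̈_i of its letters are natural numbers whose
-- sum s satisfies s + s = s; then s = 0 and every letter of u is i-neutral.
-- Blocking is inherited by any word containing a blocked factor and
-- neutrality by concatenation, so for u, v idempotent both u ++ v and v ++ u
-- are, for every i, either both blocked or both neutral. In either case
-- ë_i and f̈_i are undefined on them and their ε̈_i, φ̈_i agree, so both are
-- isolated points of 𝒬* with the same data, and the map sending one to the
-- other is an isomorphism of components.
module Submission where

open import Defs
open import Data.Bool using (Bool; true; false; if_then_else_; _∨_; _∧_)
open import Data.Bool.Properties using (∨-conicalˡ; ∨-conicalʳ; ∨-zeroʳ)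
open import Data.Empty using (⊥-elim)
open import Data.Integer as ℤ using (+_)
import Data.Integer.Properties as ℤ
open import Data.List using (List; []; _∷_; _++_)
open import Data.List.Relation.Unary.All as All using (All; []; _∷_)
open import Data.List.Relation.Unary.All.Properties using (++⁺)
open import Data.Maybe as Maybe using (Maybe; just; nothing)
open import Data.Nat as ℕ using (ℕ; suc)
import Data.Nat.Properties as ℕ
open import Data.Product using (Σ; _×_; _,_; proj₁; proj₂)
open import Data.Sum using (_⊎_; inj₁; inj₂)
open import Relation.Nullary using (yes; no)
open import Relation.Nullary.Decidable using (⌊_⌋)
open import Relation.Binary.PropositionalEquality
open import Function using (case_of_)
open import Algebra.Structures using (IsAbelianGroup)

⊕-assoc : ∀ a b c → (a ⊕ b) ⊕ c ≡ a ⊕ (b ⊕ c)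
⊕-assoc (fin x) (fin y) (fin z) = cong fin (ℤ.+-assoc x y z)
⊕-assoc (fin _) (fin _) +∞      = refl
⊕-assoc (fin _) (fin _) -∞      = refl
⊕-assoc (fin _) +∞      _       = refl
⊕-assoc (fin _) -∞      (fin _) = refl
⊕-assoc (fin _) -∞      +∞      = refl
⊕-assoc (fin _) -∞      -∞      = refl
⊕-assoc +∞      _       _       = refl
⊕-assoc -∞      (fin _) (fin _) = refl
⊕-assoc -∞      (fin _) +∞      = refl
⊕-assoc -∞      (fin _) -∞      = refl
⊕-assoc -∞      +∞      _       = refl
⊕-assoc -∞      -∞      (fin _) = refl
⊕-assoc -∞      -∞      +∞      = refl
⊕-assoc -∞      -∞      -∞      = refl

⊕-identityˡ : ∀ a → fin (+ 0) ⊕ a ≡ a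
⊕-identityˡ (fin x) = cong fin (ℤ.+-identityˡ x)
⊕-identityˡ +∞      = refl
⊕-identityˡ -∞      = refl

IsNat : ℤ∞ → Set
IsNat a = Σ ℕ λ k → a ≡ fin (+ k)

fin-+-injective : ∀ {m n} → fin (+ m) ≡ fin (+ n) → m ≡ n
fin-+-injective refl = refl

⊕-nat : ∀ {a b} → IsNat a → IsNat b → IsNat (a ⊕ b)
⊕-nat (m , refl) (n , refl) = m ℕ.+ n , refl

⊕-nat-conical : ∀ {a b} → IsNat a → IsNat b → a ⊕ b ≡ fin (+ 0) →
                a ≡ fin (+ 0) × b ≡ fin (+ 0)
⊕-nat-conical (m , refl) (n , refl) m+n≡0 =
  cong (λ k → fin (+ k)) (ℕ.m+n≡0⇒m≡0 m (fin-+-injective m+n≡0)) ,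
  cong (λ k → fin (+ k)) (ℕ.m+n≡0⇒n≡0 m (fin-+-injective m+n≡0))

⊕-nat-idem⇒0 : ∀ {a} → IsNat a → a ⊕ a ≡ a → a ≡ fin (+ 0)
⊕-nat-idem⇒0 (n , refl) n+n≡n = cong (λ k → fin (+ k))
  (ℕ.+-cancelˡ-≡ n n 0 (trans (fin-+-injective n+n≡n) (sym (ℕ.+-identityʳ n))))

⌊suc<?suc⌋ : ∀ m n → ⌊ suc m ℕ.<? suc n ⌋ ≡ ⌊ m ℕ.<? n ⌋
⌊suc<?suc⌋ m n with m ℕ.<? n | suc m ℕ.<? suc n
... | yes _   | yes _     = refl
... | no  _   | no  _     = refl
... | yes m<n | no  m+1≮n = ⊥-elim (m+1≮n (ℕ.s≤s m<n))
... | no  m≮n | yes m+1<n = ⊥-elim (m≮n (ℕ.s≤s⁻¹ m+1<n))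

∨-preserves-true : ∀ {x y x′ y′} → (x ≡ true → x′ ≡ true) → (y ≡ true → y′ ≡ true) →
                   x ∨ y ≡ true → x′ ∨ y′ ≡ true
∨-preserves-true {true}  x⇒x′ _    _      = cong (_∨ _) (x⇒x′ refl)
∨-preserves-true {false} _    y⇒y′ y≡true = trans (cong (_ ∨_) (y⇒y′ y≡true)) (∨-zeroʳ _)

∧-preservesʳ-true : ∀ {x y y′} → (y ≡ true → y′ ≡ true) → x ∧ y ≡ true → x ∧ y′ ≡ true
∧-preservesʳ-true {true} y⇒y′ = y⇒y′

module _ {A : Set} where

  Σ∞ : (A → ℤ∞) → List A → ℤ∞
  Σ∞ g []       = fin (+ 0)
  Σ∞ g (x ∷ xs) = g x ⊕ Σ∞ g xs

  Σ∞-++ : ∀ (g : A → ℤ∞) xs ys → Σ∞ g (xs ++ ys) ≡ Σ∞ g xs ⊕ Σ∞ g ys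
  Σ∞-++ g []       ys = sym (⊕-identityˡ (Σ∞ g ys))
  Σ∞-++ g (x ∷ xs) ys =
    trans (cong (g x ⊕_) (Σ∞-++ g xs ys)) (sym (⊕-assoc (g x) (Σ∞ g xs) (Σ∞ g ys)))

  Σ∞-nat : ∀ {g : A → ℤ∞} {xs} → All (λ x → IsNat (g x)) xs → IsNat (Σ∞ g xs)
  Σ∞-nat []       = 0 , refl
  Σ∞-nat (n ∷ ns) = ⊕-nat n (Σ∞-nat ns)

  Σ∞-zero : ∀ {g : A → ℤ∞} {xs} → All (λ x → g x ≡ fin (+ 0)) xs → Σ∞ g xs ≡ fin (+ 0)
  Σ∞-zero []         = refl
  Σ∞-zero (gx≡0 ∷ z) rewrite gx≡0 | Σ∞-zero z = refl

  Σ∞-nat-zero : ∀ {g : A → ℤ∞} {xs} → All (λ x → IsNat (g x)) xs → Σ∞ g xs ≡ fin (+ 0) →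
                All (λ x → g x ≡ fin (+ 0)) xs
  Σ∞-nat-zero []       _     = []
  Σ∞-nat-zero (n ∷ ns) sum≡0 =
    let gx≡0 , rest≡0 = ⊕-nat-conical n (Σ∞-nat ns) sum≡0
    in gx≡0 ∷ Σ∞-nat-zero ns rest≡0

  anyB-++ˡ : ∀ (p : A → Bool) xs ys → anyB p xs ≡ true → anyB p (xs ++ ys) ≡ true
  anyB-++ˡ p (x ∷ xs) ys any≡true with p x
  ... | true  = refl
  ... | false = anyB-++ˡ p xs ys any≡true

  anyB-++ʳ : ∀ (p : A → Bool) xs ys → anyB p ys ≡ true → anyB p (xs ++ ys) ≡ true
  anyB-++ʳ p []       ys any≡true = any≡true
  anyB-++ʳ p (x ∷ xs) ys any≡true =
    trans (cong (p x ∨_) (anyB-++ʳ p xs ys any≡true)) (∨-zeroʳ (p x))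

  anyB-false⇒All : ∀ (p : A → Bool) xs → anyB p xs ≡ false → All (λ x → p x ≡ false) xs
  anyB-false⇒All p []       _    = []
  anyB-false⇒All p (x ∷ xs) none =
    ∨-conicalˡ (p x) _ none ∷ anyB-false⇒All p xs (∨-conicalʳ (p x) _ none)

  All⇒anyB-false : ∀ {p : A → Bool} {xs} → All (λ x → p x ≡ false) xs → anyB p xs ≡ false
  All⇒anyB-false []              = refl
  All⇒anyB-false (px≡false ∷ ps) rewrite px≡false = All⇒anyB-false ps

  All⇒findLast-nothing : ∀ {p : A → Bool} {xs} → All (λ x → p x ≡ false) xs → findLast p xs ≡ nothing
  All⇒findLast-nothing []              = refl
  All⇒findLast-nothing {p} (px≡false ∷ ps)
    rewrite All⇒findLast-nothing {p} ps | px≡false = refl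

  All⇒findFirst-nothing : ∀ {p : A → Bool} {xs} → All (λ x → p x ≡ false) xs → findFirst p xs ≡ nothing
  All⇒findFirst-nothing []              = refl
  All⇒findFirst-nothing {p} (px≡false ∷ ps)
    rewrite All⇒findFirst-nothing {p} ps | px≡false = refl

  findLast-just⇒anyB : ∀ (p : A → Bool) xs {k} → findLast p xs ≡ just k → anyB p xs ≡ true
  findLast-just⇒anyB p (x ∷ xs) found with findLast p xs in eq
  ... | just _  = trans (cong (p x ∨_) (findLast-just⇒anyB p xs eq)) (∨-zeroʳ (p x))
  ... | nothing with p x
  ...   | true = refl

  findLast-nothing⇒anyB : ∀ (p : A → Bool) xs → findLast p xs ≡ nothing → anyB p xs ≡ false
  findLast-nothing⇒anyB p []       _    = refl
  findLast-nothing⇒anyB p (x ∷ xs) none with findLast p xs in eq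
  ... | nothing with p x
  ...   | false = findLast-nothing⇒anyB p xs eq

module _ {R : RootDatum} (𝒬 : QuasiCrystal R) where
  open RootDatum R
  open QuasiCrystal 𝒬
  open FreeQC 𝒬
  open IsAbelianGroup isAbelianGroup using (assoc; identityˡ; comm)

  wtW-++ : ∀ a b → wtW (a ++ b) ≡ wtW a +ᴧ wtW b
  wtW-++ []      b = sym (identityˡ (wtW b))
  wtW-++ (x ∷ a) b =
    trans (cong (wt x +ᴧ_) (wtW-++ a b)) (sym (assoc (wt x) (wtW a) (wtW b)))

  Stuck : I → Word → Set
  Stuck i w = eW i w ≡ nothing × fW i w ≡ nothing

  stuck-Reach : ∀ {w x} → (∀ i → Stuck i w) → Reach w x → x ≡ w
  stuck-Reach stuck here = refl
  stuck-Reach stuck (stepE i r e≡w) with stuck-Reach stuck r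
  ... | refl with trans (sym (proj₁ (stuck i))) e≡w
  ...   | ()
  stuck-Reach stuck (stepF i r f≡w) with stuck-Reach stuck r
  ... | refl with trans (sym (proj₂ (stuck i))) f≡w
  ...   | ()

  stuck-∼ : ∀ {a b} → (∀ i → Stuck i a) → (∀ i → Stuck i b) → wtW a ≡ wtW b →
            (∀ i → εW i a ≡ εW i b) → (∀ i → φW i a ≡ φW i b) → a ∼ b
  stuck-∼ {a} {b} stuck-a stuck-b wt≡ ε≡ φ≡ = record
    { ψ       = λ _ → b
    ; ψ⁻¹     = λ _ → a
    ; ψ-u     = refl
    ; ψ-in    = λ _ → here
    ; ψ⁻¹-in  = λ _ → here
    ; left    = λ r → sym (stuck-Reach stuck-a r)
    ; right   = λ r → sym (stuck-Reach stuck-b r)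
    ; pres-wt = λ r → at r (sym wt≡)
    ; pres-ε  = λ r i → at r (sym (ε≡ i))
    ; pres-φ  = λ r i → at r (sym (φ≡ i))
    ; pres-e  = λ r i → at r (trans (proj₁ (stuck-b i)) (sym (cong (Maybe.map _) (proj₁ (stuck-a i)))))
    ; pres-f  = λ r i → at r (trans (proj₂ (stuck-b i)) (sym (cong (Maybe.map _) (proj₂ (stuck-a i)))))
    }
    where
      at : ∀ {ℓ} {P : Word → Set ℓ} {x} → Reach a x → P a → P x
      at {P = P} r = subst P (sym (stuck-Reach stuck-a r))

  ∼⇒εW≡ : ∀ {u v} → u ∼ v → ∀ i → εW i v ≡ εW i u
  ∼⇒εW≡ iso i = trans (cong (εW i) (sym ψ-u)) (pres-ε here i)
    where open ComponentIso iso

  ∼⇒φW≡ : ∀ {u v} → u ∼ v → ∀ i → φW i v ≡ φW i u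
  ∼⇒φW≡ iso i = trans (cong (φW i) (sym ψ-u)) (pres-φ here i)
    where open ComponentIso iso

  module _ (i : I) where

    ε⁺ φ⁺ ε∞ : Q → Bool
    ε⁺ x = pos (ε i x)
    φ⁺ x = pos (φ i x)
    ε∞ x = isPlusInf (ε i x)

    -- The condition p > q of the definition of 𝒬*, read on letters.
    inverted : Word → Bool
    inverted []      = false
    inverted (x ∷ w) = (φ⁺ x ∧ anyB ε⁺ w) ∨ inverted w

    pGtq-∷ : ∀ x w → pGtq (pIdx i (x ∷ w)) (qIdx i (x ∷ w))
                   ≡ (φ⁺ x ∧ anyB ε⁺ w) ∨ pGtq (pIdx i w) (qIdx i w)
    pGtq-∷ x w with findLast ε⁺ w in last | φ⁺ x
    ... | just k  | true  =
      sym (cong (_∨ pGtq (just k) (qIdx i w)) (findLast-just⇒anyB ε⁺ w last))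
    ... | just k  | false with findFirst φ⁺ w
    ...   | nothing = refl
    ...   | just q  = ⌊suc<?suc⌋ q k
    pGtq-∷ x w | nothing | true with ε⁺ x
    ...   | true  = sym (cong (_∨ false) (findLast-nothing⇒anyB ε⁺ w last))
    ...   | false = sym (cong (_∨ false) (findLast-nothing⇒anyB ε⁺ w last))
    pGtq-∷ x w | nothing | false with ε⁺ x | findFirst φ⁺ w
    ...   | true  | nothing = refl
    ...   | true  | just _  = refl
    ...   | false | nothing = refl
    ...   | false | just _  = refl

    pGtq≡inverted : ∀ w → pGtq (pIdx i w) (qIdx i w) ≡ inverted w
    pGtq≡inverted []      = refl
    pGtq≡inverted (x ∷ w) =
      trans (pGtq-∷ x w) (cong ((φ⁺ x ∧ anyB ε⁺ w) ∨_) (pGtq≡inverted w))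

    inverted-++ˡ : ∀ a b → inverted a ≡ true → inverted (a ++ b) ≡ true
    inverted-++ˡ (x ∷ a) b =
      ∨-preserves-true (∧-preservesʳ-true (anyB-++ˡ ε⁺ a b)) (inverted-++ˡ a b)

    inverted-++ʳ : ∀ a b → inverted b ≡ true → inverted (a ++ b) ≡ true
    inverted-++ʳ []      b inv = inv
    inverted-++ʳ (x ∷ a) b inv =
      trans (cong (φ⁺ x ∧ anyB ε⁺ (a ++ b) ∨_) (inverted-++ʳ a b inv)) (∨-zeroʳ _)

    blocked≡ : ∀ w → blocked i w ≡ anyB ε∞ w ∨ inverted w
    blocked≡ w = cong (anyB ε∞ w ∨_) (pGtq≡inverted w)

    blocked-++ˡ : ∀ a b → blocked i a ≡ true → blocked i (a ++ b) ≡ true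
    blocked-++ˡ a b blk = trans (blocked≡ (a ++ b))
      (∨-preserves-true (anyB-++ˡ ε∞ a b) (inverted-++ˡ a b) (trans (sym (blocked≡ a)) blk))

    blocked-++ʳ : ∀ a b → blocked i b ≡ true → blocked i (a ++ b) ≡ true
    blocked-++ʳ a b blk = trans (blocked≡ (a ++ b))
      (∨-preserves-true (anyB-++ʳ ε∞ a b) (inverted-++ʳ a b) (trans (sym (blocked≡ b)) blk))

    blocked-stuck : ∀ w → blocked i w ≡ true → Stuck i w
    blocked-stuck w blk with blocked i w
    blocked-stuck w refl | true = refl , refl

    Neutral : Word → Set
    Neutral w = All (λ x → ε i x ≡ fin (+ 0)) w × All (λ x → φ i x ≡ fin (+ 0)) w

    neutral-++ : ∀ {a b} → Neutral a → Neutral b → Neutral (a ++ b)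
    neutral-++ (εa , φa) (εb , φb) = ++⁺ εa εb , ++⁺ φa φb

    neutral-pIdx : ∀ {w} → Neutral w → pIdx i w ≡ nothing
    neutral-pIdx (ε≡0 , _) = All⇒findLast-nothing (All.map (cong pos) ε≡0)

    neutral-qIdx : ∀ {w} → Neutral w → qIdx i w ≡ nothing
    neutral-qIdx (_ , φ≡0) = All⇒findFirst-nothing (All.map (cong pos) φ≡0)

    neutral-unblocked : ∀ {w} → Neutral w → blocked i w ≡ false
    neutral-unblocked {w} n@(ε≡0 , _) =
      cong₂ _∨_ (All⇒anyB-false (All.map (cong isPlusInf) ε≡0))
                (cong (λ p → pGtq p (qIdx i w)) (neutral-pIdx n))

    neutral-stuck : ∀ {w} → Neutral w → Stuck i w
    neutral-stuck n
      rewrite neutral-unblocked n | neutral-pIdx n | neutral-qIdx n = refl , refl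

    blocked-εW : ∀ w → blocked i w ≡ true → εW i w ≡ +∞
    blocked-εW w blk rewrite blk = refl

    blocked-φW : ∀ w → blocked i w ≡ true → φW i w ≡ +∞
    blocked-φW w blk rewrite blk = refl

    εW-Σ∞ : ∀ w → εW i w ≡ (if blocked i w then +∞ else Σ∞ (ε i) w)
    εW-Σ∞ w = cong (if blocked i w then +∞ else_) (sumε≡Σ∞ w)
      where
        sumε≡Σ∞ : ∀ w → sumε i w ≡ Σ∞ (ε i) w
        sumε≡Σ∞ []      = refl
        sumε≡Σ∞ (x ∷ w) = cong (ε i x ⊕_) (sumε≡Σ∞ w)

    φW-Σ∞ : ∀ w → φW i w ≡ (if blocked i w then +∞ else Σ∞ (φ i) w)
    φW-Σ∞ w = cong (if blocked i w then +∞ else_) (sumφ≡Σ∞ w)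
      where
        sumφ≡Σ∞ : ∀ w → sumφ i w ≡ Σ∞ (φ i) w
        sumφ≡Σ∞ []      = refl
        sumφ≡Σ∞ (x ∷ w) = cong (φ i x ⊕_) (sumφ≡Σ∞ w)

    neutral-εW : ∀ {w} → Neutral w → εW i w ≡ fin (+ 0)
    neutral-εW {w} n@(ε≡0 , _) =
      trans (εW-Σ∞ w) (trans (cong (if_then +∞ else Σ∞ (ε i) w) (neutral-unblocked n)) (Σ∞-zero ε≡0))

    neutral-φW : ∀ {w} → Neutral w → φW i w ≡ fin (+ 0)
    neutral-φW {w} n@(_ , φ≡0) =
      trans (φW-Σ∞ w) (trans (cong (if_then +∞ else Σ∞ (φ i) w) (neutral-unblocked n)) (Σ∞-zero φ≡0))

    unblocked-nat : Seminormal 𝒬 → ∀ {w} → blocked i w ≡ false →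
                    All (λ x → IsNat (ε i x)) w × All (λ x → IsNat (φ i x)) w
    unblocked-nat sn {w} unblk = All.map proj₁ nats , All.map proj₂ nats
      where
        finite : ∀ {x} → ε∞ x ≡ false → IsNat (ε i x) × IsNat (φ i x)
        finite {x} not∞ with sn i x (λ ε≡∞ → case trans (sym (cong isPlusInf ε≡∞)) not∞ of λ ())
        ... | (k , ε≡k , _) , (l , φ≡l , _) = (k , ε≡k) , (l , φ≡l)

        nats = All.map finite (anyB-false⇒All ε∞ w (∨-conicalˡ _ _ (trans (sym (blocked≡ w)) unblk)))

    idempotent-neutral : Seminormal 𝒬 → ∀ {u} → (u ++ u) ∼ u → blocked i u ≡ false → Neutral u
    idempotent-neutral sn {u} idem unblk =
        vanishes (ε i) (εW i) εW-Σ∞ (∼⇒εW≡ idem i) (proj₁ (unblocked-nat sn unblk))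
      , vanishes (φ i) (φW i) φW-Σ∞ (∼⇒φW≡ idem i) (proj₂ (unblocked-nat sn unblk))
      where
        vanishes : ∀ (g : Q → ℤ∞) (W : Word → ℤ∞) → (∀ w → W w ≡ (if blocked i w then +∞ else Σ∞ g w)) →
                   W u ≡ W (u ++ u) → All (λ x → IsNat (g x)) u → All (λ x → g x ≡ fin (+ 0)) u
        vanishes g W W-Σ∞ W-fixed nats = Σ∞-nat-zero nats (⊕-nat-idem⇒0 (Σ∞-nat nats) doubled)
          where
            W-u : W u ≡ Σ∞ g u
            W-u = trans (W-Σ∞ u) (cong (if_then +∞ else Σ∞ g u) unblk)

            doubled : Σ∞ g u ⊕ Σ∞ g u ≡ Σ∞ g u
            doubled with blocked i (u ++ u) | W-Σ∞ (u ++ u) | Σ∞-nat nats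
            ... | true  | W-uu | (n , s≡n) =
              case trans (sym W-uu) (trans (sym W-fixed) (trans W-u s≡n)) of λ ()
            ... | false | W-uu | _ = begin
              Σ∞ g u ⊕ Σ∞ g u  ≡⟨ Σ∞-++ g u u ⟨
              Σ∞ g (u ++ u)    ≡⟨ W-uu ⟨
              W (u ++ u)       ≡⟨ W-fixed ⟨
              W u              ≡⟨ W-u ⟩
              Σ∞ g u           ∎
              where open ≡-Reasoning

    idempotent-blocked⊎neutral : Seminormal 𝒬 → ∀ {u} → (u ++ u) ∼ u → blocked i u ≡ true ⊎ Neutral u
    idempotent-blocked⊎neutral sn {u} idem with blocked i u in blk
    ... | true  = inj₁ refl
    ... | false = inj₂ (idempotent-neutral sn idem blk)

  wtW-++-comm : ∀ a b → wtW (a ++ b) ≡ wtW (b ++ a)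
  wtW-++-comm a b = trans (wtW-++ a b) (trans (comm (wtW a) (wtW b)) (sym (wtW-++ b a)))

  data BothInert (i : I) (a b : Word) : Set where
    both-blocked : blocked i a ≡ true → blocked i b ≡ true → BothInert i a b
    both-neutral : Neutral i a → Neutral i b → BothInert i a b

  module _ {i : I} {a b : Word} where

    bothInert-stuckˡ : BothInert i a b → Stuck i a
    bothInert-stuckˡ (both-blocked blk _) = blocked-stuck i a blk
    bothInert-stuckˡ (both-neutral n _)   = neutral-stuck i n

    bothInert-stuckʳ : BothInert i a b → Stuck i b
    bothInert-stuckʳ (both-blocked _ blk) = blocked-stuck i b blk
    bothInert-stuckʳ (both-neutral _ n)   = neutral-stuck i n

    bothInert-εW : BothInert i a b → εW i a ≡ εW i b
    bothInert-εW (both-blocked blk-a blk-b) = trans (blocked-εW i a blk-a) (sym (blocked-εW i b blk-b))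
    bothInert-εW (both-neutral n-a n-b)     = trans (neutral-εW i n-a) (sym (neutral-εW i n-b))

    bothInert-φW : BothInert i a b → φW i a ≡ φW i b
    bothInert-φW (both-blocked blk-a blk-b) = trans (blocked-φW i a blk-a) (sym (blocked-φW i b blk-b))
    bothInert-φW (both-neutral n-a n-b)     = trans (neutral-φW i n-a) (sym (neutral-φW i n-b))

  idempotents-bothInert : Seminormal 𝒬 → ∀ {u v} → (u ++ u) ∼ u → (v ++ v) ∼ v →
                          ∀ i → BothInert i (u ++ v) (v ++ u)
  idempotents-bothInert sn {u} {v} u-idem v-idem i
    with idempotent-blocked⊎neutral i sn u-idem | idempotent-blocked⊎neutral i sn v-idem
  ... | inj₁ blk-u | _          = both-blocked (blocked-++ˡ i u v blk-u) (blocked-++ʳ i v u blk-u)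
  ... | inj₂ _     | inj₁ blk-v = both-blocked (blocked-++ʳ i u v blk-v) (blocked-++ˡ i v u blk-v)
  ... | inj₂ n-u   | inj₂ n-v   = both-neutral (neutral-++ i n-u n-v) (neutral-++ i n-v n-u)

corollary7p7 : (R : RootDatum) (𝒬 : QuasiCrystal R) → Seminormal 𝒬 →
    let open FreeQC 𝒬 in
    ∀ (u v : Word) → (u ++ u) ∼ u → (v ++ v) ∼ v → (u ++ v) ∼ (v ++ u)
corollary7p7 R 𝒬 sn u v u-idem v-idem =
  stuck-∼ 𝒬 (λ i → bothInert-stuckˡ 𝒬 (inert i)) (λ i → bothInert-stuckʳ 𝒬 (inert i))
    (wtW-++-comm 𝒬 u v) (λ i → bothInert-εW 𝒬 (inert i)) (λ i → bothInert-φW 𝒬 (inert i))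
  where
    inert = idempotents-bothInert 𝒬 sn u-idem v-idem
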